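{- Let $n,t$ be positive integers and let $G$ be a graph such that every red/blue-coloring of the edges of $G$ contains either an induced copy of $K_{1,t}$ all of whose edges are red or an induced copy of $M_n$ all of whose edges are blue. Then $G$ contains a subgraph which is an $(n,t)$-Ruzsa--Szemerédi graph.
   Context: $K_{1,t}$ is the star with $t$ edges and $M_n$ is the matching with $n$ edges. An induced copy of $H$ in $G$ is a subgraph $H'\cong H$ of $G$ such that two vertices of $H'$ are adjacent in $H'$ iff they are adjacent in $G$. A graph is an $(n,t)$-Ruzsa--Szemerédi graph if its edge set is the union of $t$ pairwise disjoint induced matchings (in that graph), each of size $n$. -}

module Defs where

open import Data.Nat using (ℕ)
open import Data.Fin using (Fin)
open import Data.Bool using (Bool; true; false)
open import Data.Product using (Σ; _×_; _,_; ∃; ∃-syntax)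
open import Data.Sum using (_⊎_)
open import Relation.Binary.PropositionalEquality using (_≡_; _≢_)
open import Relation.Nullary using (¬_)
open import Function.Definitions using (Injective)

record Graph (N : ℕ) : Set where
  field
    adj   : Fin N → Fin N → Bool
    sym   : ∀ u v → adj u v ≡ adj v u
    irref : ∀ v → adj v v ≡ false
open Graph public

Edge : ∀ {N} → Graph N → Fin N → Fin N → Set
Edge G u v = adj G u v ≡ true

_⊆G_ : ∀ {N} → Graph N → Graph N → Set
H ⊆G G = ∀ u v → Edge H u v → Edge G u v

-- Red/blue colourings of the edges: a symmetric colour assignment on vertex pairs
-- (only the values on edges matter).
data Colour : Set where
  red blue : Colour

record Colouring {N : ℕ} (G : Graph N) : Set where
  field
    col    : Fin N → Fin N → Colour
    colSym : ∀ u v → col u v ≡ col v u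
open Colouring public

record InducedStar {N : ℕ} (G : Graph N) (t : ℕ) : Set where
  field
    centre : Fin N
    leaf   : Fin t → Fin N
    leafInj  : Injective _≡_ _≡_ leaf
    spoke    : ∀ i → Edge G centre (leaf i)
    noLeafEdge : ∀ i j → ¬ Edge G (leaf i) (leaf j)
open InducedStar public

SamePair : ∀ {N} → Fin N → Fin N → Fin N → Fin N → Set
SamePair x y u v = (x ≡ u × y ≡ v) ⊎ (x ≡ v × y ≡ u)

record IsInducedMatching {N n : ℕ} (G : Graph N) (a b : Fin n → Fin N) : Set where
  field
    aInj   : Injective _≡_ _≡_ a
    bInj   : Injective _≡_ _≡_ b
    abDist : ∀ i j → a i ≢ b j
    isEdge : ∀ i → Edge G (a i) (b i)
    noCross : ∀ i j → i ≢ j → ∀ x y →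
              (x ≡ a i ⊎ x ≡ b i) → (y ≡ a j ⊎ y ≡ b j) → ¬ Edge G x y

record InducedMatching {N : ℕ} (G : Graph N) (n : ℕ) : Set where
  field
    a b : Fin n → Fin N
    induced : IsInducedMatching G a b
open InducedMatching public

RedStar : ∀ {N} (G : Graph N) → Colouring G → ℕ → Set
RedStar G c t = Σ (InducedStar G t) λ S → ∀ i → col c (centre S) (leaf S i) ≡ red

BlueMatching : ∀ {N} (G : Graph N) → Colouring G → ℕ → Set
BlueMatching G c n = Σ (InducedMatching G n) λ M → ∀ i → col c (a M i) (b M i) ≡ blue

record IsRuzsaSzemeredi {N : ℕ} (H : Graph N) (n t : ℕ) : Set where
  field
    ma mb    : Fin t → Fin n → Fin N
    induced  : ∀ k → IsInducedMatching H (ma k) (mb k)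
    covers   : ∀ u v → Edge H u v → ∃[ k ] ∃[ i ] SamePair u v (ma k i) (mb k i)
    disjoint : ∀ k k' → k ≢ k' → ∀ i i' →
               ¬ SamePair (ma k i) (mb k i) (ma k' i') (mb k' i')

-- Grow greedily a family of edge-disjoint induced n-matchings of G. Colour the edges
-- covered by the family red and the others blue. An all-blue induced M_n consists of
-- uncovered edges, so it can be added to the family, and the number of uncovered edges
-- drops; hence eventually an all-red induced K_{1,t} appears. Its t spokes lie in t
-- distinct matchings of the family, because a matching has at most one edge at the
-- centre, and the union of those t matchings is an (n,t)-Ruzsa–Szemerédi subgraph:
-- a matching induced in G stays induced in any subgraph containing its edges.
module Submission where

open import Defs
open import Algebra.Properties.Monoid.Sum using (sum)
open import Data.Bool using (Bool; true; if_then_else_) renaming (_≟_ to _≟ᵇ_)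
open import Data.Empty using (⊥-elim)
open import Data.Fin using (Fin; zero; suc; _≟_)
open import Data.Fin.Properties using (any?)
open import Data.Nat using (ℕ; zero; suc; NonZero; _≤_; _<_; z≤n; s≤s)
open import Data.Nat.Induction using (<-wellFounded)
open import Data.Nat.Properties using (+-0-monoid; +-mono-≤; +-mono-<-≤; +-mono-≤-<)
open import Data.Product using (Σ; _×_; _,_; proj₁; ∃-syntax)
open import Data.Sum using (_⊎_; inj₁; inj₂)
open import Function.Bundles using (mk⇔)
open import Function.Definitions using (Injective)
open import Induction.WellFounded using (Acc; acc)
open import Relation.Binary.PropositionalEquality
  using (_≡_; _≢_; refl; cong; trans) renaming (sym to ≡-sym)
open import Relation.Nullary using (¬_; Dec; yes; no; does; ¬?)
open import Relation.Nullary.Decidable using (_×-dec_; _⊎-dec_; dec-true; dec-false; does-⇔)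

private
  variable
    A B : Set
    N n m t : ℕ

∑ : (Fin m → ℕ) → ℕ
∑ = sum +-0-monoid

∑-mono-≤ : {f g : Fin m → ℕ} → (∀ i → f i ≤ g i) → ∑ f ≤ ∑ g
∑-mono-≤ {zero}  f≤g = z≤n
∑-mono-≤ {suc m} f≤g = +-mono-≤ (f≤g zero) (∑-mono-≤ λ i → f≤g (suc i))

∑-mono-< : {f g : Fin m → ℕ} → (∀ i → f i ≤ g i) → ∀ j → f j < g j → ∑ f < ∑ g
∑-mono-< f≤g zero    fj<gj = +-mono-<-≤ fj<gj (∑-mono-≤ λ i → f≤g (suc i))
∑-mono-< f≤g (suc j) fj<gj = +-mono-≤-< (f≤g zero) (∑-mono-< (λ i → f≤g (suc i)) j fj<gj)

𝟙 : Dec A → ℕ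
𝟙 (yes _) = 1
𝟙 (no _)  = 0

𝟙-mono : (A → B) → (a? : Dec A) (b? : Dec B) → 𝟙 a? ≤ 𝟙 b?
𝟙-mono f (yes a) (yes _) = s≤s z≤n
𝟙-mono f (yes a) (no ¬b) = ⊥-elim (¬b (f a))
𝟙-mono f (no _)  _       = z≤n

𝟙-< : ¬ A → B → (a? : Dec A) (b? : Dec B) → 𝟙 a? < 𝟙 b?
𝟙-< ¬a b (yes a) _       = ⊥-elim (¬a a)
𝟙-< ¬a b (no _)  (yes _) = s≤s z≤n
𝟙-< ¬a b (no _)  (no ¬b) = ⊥-elim (¬b b)

does-true⇒ : (a? : Dec A) → does a? ≡ true → A
does-true⇒ (yes a) _ = a

redIfTrue : Bool → Colour
redIfTrue b = if b then red else blue

redIf : Dec A → Colour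
redIf a? = redIfTrue (does a?)

redIf-red⇒ : (a? : Dec A) → redIf a? ≡ red → A
redIf-red⇒ (yes a) _ = a

redIf-blue⇒ : (a? : Dec A) → redIf a? ≡ blue → ¬ A
redIf-blue⇒ (no ¬a) _ = ¬a

module _ {x y u v : Fin N} where

  SamePair-swapˡ : SamePair u v x y → SamePair v u x y
  SamePair-swapˡ (inj₁ (p , q)) = inj₂ (q , p)
  SamePair-swapˡ (inj₂ (p , q)) = inj₁ (q , p)

  SamePair-sym : SamePair u v x y → SamePair x y u v
  SamePair-sym (inj₁ (p , q)) = inj₁ (≡-sym p , ≡-sym q)
  SamePair-sym (inj₂ (p , q)) = inj₂ (≡-sym q , ≡-sym p)

  SamePair-fst : SamePair u v x y → u ≡ x ⊎ u ≡ y
  SamePair-fst (inj₁ (p , _)) = inj₁ p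
  SamePair-fst (inj₂ (p , _)) = inj₂ p

SamePair-loop : {v x y : Fin N} → SamePair v v x y → x ≡ y
SamePair-loop (inj₁ (p , q)) = trans (≡-sym p) q
SamePair-loop (inj₂ (p , q)) = trans (≡-sym q) p

SamePair? : (u v x y : Fin N) → Dec (SamePair u v x y)
SamePair? u v x y = ((u ≟ x) ×-dec (v ≟ y)) ⊎-dec ((u ≟ y) ×-dec (v ≟ x))

Edge? : (G : Graph N) → ∀ u v → Dec (Edge G u v)
Edge? G u v = adj G u v ≟ᵇ true

Edge-sym : (G : Graph N) {u v : Fin N} → Edge G u v → Edge G v u
Edge-sym G {u} {v} e = trans (sym G v u) e

module _ {G : Graph N} {a b : Fin n → Fin N} (M : IsInducedMatching G a b) where
  open IsInducedMatching M

  IsInducedMatching-edge : ∀ {u v} i → SamePair u v (a i) (b i) → Edge G u v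
  IsInducedMatching-edge i (inj₁ (refl , refl)) = isEdge i
  IsInducedMatching-edge i (inj₂ (refl , refl)) = Edge-sym G (isEdge i)

  IsInducedMatching-index-unique : ∀ {c} i j → c ≡ a i ⊎ c ≡ b i → c ≡ a j ⊎ c ≡ b j → i ≡ j
  IsInducedMatching-index-unique i j (inj₁ p) (inj₁ q) = aInj (trans (≡-sym p) q)
  IsInducedMatching-index-unique i j (inj₁ p) (inj₂ q) = ⊥-elim (abDist i j (trans (≡-sym p) q))
  IsInducedMatching-index-unique i j (inj₂ p) (inj₁ q) = ⊥-elim (abDist j i (trans (≡-sym q) p))
  IsInducedMatching-index-unique i j (inj₂ p) (inj₂ q) = bInj (trans (≡-sym p) q)

  IsInducedMatching-partner-unique : ∀ {c ℓ ℓ′} i j →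
    SamePair c ℓ (a i) (b i) → SamePair c ℓ′ (a j) (b j) → ℓ ≡ ℓ′
  IsInducedMatching-partner-unique i j s s′
    with refl ← IsInducedMatching-index-unique i j (SamePair-fst s) (SamePair-fst s′) = sameEdge s s′
    where
    sameEdge : ∀ {c ℓ ℓ′} → SamePair c ℓ (a i) (b i) → SamePair c ℓ′ (a i) (b i) → ℓ ≡ ℓ′
    sameEdge (inj₁ (_ , q)) (inj₁ (_ , q′)) = trans q (≡-sym q′)
    sameEdge (inj₁ (p , _)) (inj₂ (p′ , _)) = ⊥-elim (abDist i i (trans (≡-sym p) p′))
    sameEdge (inj₂ (p , _)) (inj₁ (p′ , _)) = ⊥-elim (abDist i i (trans (≡-sym p′) p))
    sameEdge (inj₂ (_ , q)) (inj₂ (_ , q′)) = trans q (≡-sym q′)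

IsInducedMatching-⊆ : {H G : Graph N} {a b : Fin n → Fin N} → H ⊆G G →
  (∀ i → Edge H (a i) (b i)) → IsInducedMatching G a b → IsInducedMatching H a b
IsInducedMatching-⊆ H⊆G edges M = record
  { aInj = aInj ; bInj = bInj ; abDist = abDist ; isEdge = edges
  ; noCross = λ i j i≢j x y x∈i y∈j e → noCross i j i≢j x y x∈i y∈j (H⊆G x y e) }
  where open IsInducedMatching M

module _ (ma mb : Fin m → Fin n → Fin N) where

  Covered : Fin N → Fin N → Set
  Covered u v = ∃[ k ] ∃[ i ] SamePair u v (ma k i) (mb k i)

  Covered? : ∀ u v → Dec (Covered u v)
  Covered? u v = any? λ k → any? λ i → SamePair? u v (ma k i) (mb k i)

  Covered-sym : ∀ {u v} → Covered u v → Covered v u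
  Covered-sym (k , i , s) = k , i , SamePair-swapˡ s

  unionGraph : (∀ k i → ma k i ≢ mb k i) → Graph N
  unionGraph loopless = record
    { adj   = λ u v → does (Covered? u v)
    ; sym   = λ u v → does-⇔ (mk⇔ Covered-sym Covered-sym) (Covered? u v) (Covered? v u)
    ; irref = λ v → dec-false (Covered? v v) λ (k , i , s) → loopless k i (SamePair-loop s) }

record DisjointInducedMatchings (G : Graph N) (n m : ℕ) : Set where
  field
    ma mb    : Fin m → Fin n → Fin N
    induced  : ∀ k → IsInducedMatching G (ma k) (mb k)
    disjoint : ∀ k k′ → k ≢ k′ → ∀ i i′ →
               ¬ SamePair (ma k i) (mb k i) (ma k′ i′) (mb k′ i′)

module _ {G : Graph N} where
  open DisjointInducedMatchings

  Covers : DisjointInducedMatchings G n m → Fin N → Fin N → Set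
  Covers P = Covered (ma P) (mb P)

  Covers? : (P : DisjointInducedMatchings G n m) → ∀ u v → Dec (Covers P u v)
  Covers? P = Covered? (ma P) (mb P)

  noMatchings : DisjointInducedMatchings G n 0
  noMatchings = record { ma = λ () ; mb = λ () ; induced = λ () ; disjoint = λ () }

  extend : (P : DisjointInducedMatchings G n m) (M : InducedMatching G n) →
           (∀ i → ¬ Covers P (a M i) (b M i)) → DisjointInducedMatchings G n (suc m)
  extend {n = n} {m = m} P M uncovered =
    record { ma = ma′ ; mb = mb′ ; induced = induced′ ; disjoint = disjoint′ }
    where
    ma′ mb′ : Fin (suc m) → Fin n → Fin N
    ma′ zero    = a M
    ma′ (suc k) = ma P k
    mb′ zero    = b M
    mb′ (suc k) = mb P k
    induced′ : ∀ k → IsInducedMatching G (ma′ k) (mb′ k)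
    induced′ zero    = InducedMatching.induced M
    induced′ (suc k) = induced P k
    disjoint′ : ∀ k k′ → k ≢ k′ → ∀ i i′ → ¬ SamePair (ma′ k i) (mb′ k i) (ma′ k′ i′) (mb′ k′ i′)
    disjoint′ zero    zero     0≢0 = ⊥-elim (0≢0 refl)
    disjoint′ zero    (suc k′) _ i i′ s = uncovered i (k′ , i′ , s)
    disjoint′ (suc k) zero     _ i i′ s = uncovered i′ (k , i , SamePair-sym s)
    disjoint′ (suc k) (suc k′) k≢k′ = disjoint P k k′ (λ k≡k′ → k≢k′ (cong suc k≡k′))

  restrict : (P : DisjointInducedMatchings G n m) (σ : Fin t → Fin m) → Injective _≡_ _≡_ σ →
             DisjointInducedMatchings G n t
  restrict P σ σ-inj = record
    { ma = λ k → ma P (σ k) ; mb = λ k → mb P (σ k) ; induced = λ k → induced P (σ k)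
    ; disjoint = λ k k′ k≢k′ → disjoint P (σ k) (σ k′) (λ e → k≢k′ (σ-inj e)) }

  coverColouring : DisjointInducedMatchings G n m → Colouring G
  coverColouring P = record
    { col    = λ u v → redIf (Covers? P u v)
    ; colSym = λ u v →
        cong redIfTrue (does-⇔ (mk⇔ covers-sym covers-sym) (Covers? P u v) (Covers? P v u)) }
    where covers-sym = Covered-sym (ma P) (mb P)

  Uncovered : DisjointInducedMatchings G n m → Fin N → Fin N → Set
  Uncovered P u v = Edge G u v × ¬ Covers P u v

  Uncovered? : (P : DisjointInducedMatchings G n m) → ∀ u v → Dec (Uncovered P u v)
  Uncovered? P u v = Edge? G u v ×-dec ¬? (Covers? P u v)

  uncoveredEdges : DisjointInducedMatchings G n m → ℕ
  uncoveredEdges P = ∑ λ u → ∑ λ v → 𝟙 (Uncovered? P u v)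

  extend-uncoveredEdges : .{{NonZero n}} → (P : DisjointInducedMatchings G n m) (M : InducedMatching G n)
    (uncovered : ∀ i → ¬ Covers P (a M i) (b M i)) →
    uncoveredEdges (extend P M uncovered) < uncoveredEdges P
  extend-uncoveredEdges {n = suc _} P M uncovered =
    ∑-mono-< (λ u → ∑-mono-≤ (fewer u)) (a M zero)
      (∑-mono-< (fewer (a M zero)) (b M zero)
        (𝟙-< (λ (_ , ¬cov) → ¬cov (zero , zero , inj₁ (refl , refl)))
             (IsInducedMatching.isEdge (InducedMatching.induced M) zero , uncovered zero) _ _))
    where
    fewer : ∀ u v → 𝟙 (Uncovered? (extend P M uncovered) u v) ≤ 𝟙 (Uncovered? P u v)
    fewer u v = 𝟙-mono (λ (e , ¬cov′) → e , λ (k , i , s) → ¬cov′ (suc k , i , s)) _ _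

  spokeCover : (P : DisjointInducedMatchings G n m) (star : RedStar G (coverColouring P) t) →
               ∀ i → Covers P (centre (proj₁ star)) (leaf (proj₁ star) i)
  spokeCover P (S , allRed) i = redIf-red⇒ (Covers? P _ _) (allRed i)

  spokeMatching : (P : DisjointInducedMatchings G n m) → RedStar G (coverColouring P) t → Fin t → Fin m
  spokeMatching P star i = proj₁ (spokeCover P star i)

  spokeMatching-injective : (P : DisjointInducedMatchings G n m) (star : RedStar G (coverColouring P) t) →
                            Injective _≡_ _≡_ (spokeMatching P star)
  spokeMatching-injective P star {i} {j} kᵢ≡kⱼ with spokeCover P star i | spokeCover P star j
  ... | k , p , sᵢ | k′ , q , sⱼ with refl ← kᵢ≡kⱼ =
    leafInj (proj₁ star) (IsInducedMatching-partner-unique (induced P k) p q sᵢ sⱼ)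

  growMatchings : ((c : Colouring G) → RedStar G c t ⊎ BlueMatching G c n) → .{{NonZero n}} →
    (P : DisjointInducedMatchings G n m) → Acc _<_ (uncoveredEdges P) → DisjointInducedMatchings G n t
  growMatchings hyp P (acc smaller) with hyp (coverColouring P)
  ... | inj₁ star          = restrict P (spokeMatching P star) (spokeMatching-injective P star)
  ... | inj₂ (M , allBlue) = growMatchings hyp (extend P M uncovered)
                               (smaller (extend-uncoveredEdges P M uncovered))
    where
    uncovered : ∀ i → ¬ Covers P (a M i) (b M i)
    uncovered i = redIf-blue⇒ (Covers? P _ _) (allBlue i)

  unionGraph-isRuzsaSzemeredi : DisjointInducedMatchings G n m →
    Σ (Graph N) λ H → H ⊆G G × IsRuzsaSzemeredi H n m
  unionGraph-isRuzsaSzemeredi P = H , H⊆G , record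
    { ma = ma P ; mb = mb P ; disjoint = disjoint P
    ; induced = λ k → IsInducedMatching-⊆ H⊆G
                        (λ i → dec-true (Covers? P _ _) (k , i , inj₁ (refl , refl))) (induced P k)
    ; covers = λ u v → does-true⇒ (Covers? P u v) }
    where
    H : Graph N
    H = unionGraph (ma P) (mb P) λ k i → IsInducedMatching.abDist (induced P k) i i
    H⊆G : H ⊆G G
    H⊆G u v e with k , i , s ← does-true⇒ (Covers? P u v) e = IsInducedMatching-edge (induced P k) i s

theorem6p1 : (n t : ℕ) → NonZero n → NonZero t → (N : ℕ) → (G : Graph N) →
    ((c : Colouring G) → RedStar G c t ⊎ BlueMatching G c n) →
    Σ (Graph N) (λ H → (H ⊆G G) × IsRuzsaSzemeredi H n t)
theorem6p1 n t n≢0 _ N G hyp =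
  unionGraph-isRuzsaSzemeredi (growMatchings hyp {{n≢0}} noMatchings (<-wellFounded _))
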